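{- If $G$ is a connected graph with a nonempty annulus $A(G)$, then $\mathrm{rad}(G)\ge 2$, $\mathrm{diam}(G)\ge 4$, and $|A(G)|\ge 2$.
   Context: All graphs are finite and simple. For a connected graph $G$, the eccentricity of a vertex $v$ is $e(v)=\max\{d(v,u): u\in V(G)\}$; $\mathrm{rad}(G)$ and $\mathrm{diam}(G)$ are the minimum and maximum eccentricities. The annulus $A(G)$ is the set of vertices $w$ with $\mathrm{rad}(G)<e(w)<\mathrm{diam}(G)$. -}

module Defs where

open import Data.Nat using (ℕ; zero; suc; _≤_; _<_)
open import Data.Fin using (Fin)
open import Data.Bool using (Bool; true; false)
open import Data.Product using (Σ; ∃; ∃-syntax; _×_; _,_)
open import Relation.Binary.PropositionalEquality using (_≡_)

record Graph : Set where
  field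
    n     : ℕ
    adj   : Fin n → Fin n → Bool
    sym   : ∀ u v → adj u v ≡ adj v u
    loopless : ∀ v → adj v v ≡ false

open Graph public

module _ (G : Graph) where

  Vertex : Set
  Vertex = Fin (n G)

  data Walk : Vertex → Vertex → ℕ → Set where
    here : ∀ {u} → Walk u u zero
    step : ∀ {u w v k} → adj G u w ≡ true → Walk w v k → Walk u v (suc k)

  Connected : Set
  Connected = ∀ u v → ∃[ k ] Walk u v k

  IsDist : Vertex → Vertex → ℕ → Set
  IsDist u v k = Walk u v k × (∀ m → Walk u v m → k ≤ m)

  IsEcc : Vertex → ℕ → Set
  IsEcc v e = (∀ u k → IsDist v u k → k ≤ e) × (∃[ u ] IsDist v u e)

  IsRad : ℕ → Set
  IsRad r = (∃[ v ] IsEcc v r) × (∀ v e → IsEcc v e → r ≤ e)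

  IsDiam : ℕ → Set
  IsDiam d = (∃[ v ] IsEcc v d) × (∀ v e → IsEcc v e → e ≤ d)

  InAnnulus : ℕ → ℕ → Vertex → Set
  InAnnulus r d w = ∃[ e ] (IsEcc w e × r < e × e < d)

{-# OPTIONS --safe #-}
-- Eccentricities of adjacent vertices differ by at most one, and diam ≤ 2 rad
-- because any two vertices are joined through a centre.  An annulus vertex x
-- gives rad + 2 ≤ e(x) + 1 ≤ diam ≤ 2 rad, hence rad ≥ 2 and diam ≥ 4.  If x
-- were the only vertex of eccentricity rad + 1, the vertices of eccentricity
-- ≤ rad would be closed under stepping to neighbours other than x, so every
-- shortest walk from such a vertex to one of larger eccentricity passes
-- through x.  Applied to a shortest walk from an eccentric vertex y of x to a
-- peripheral vertex, or from a centre to y, this yields d(x, y) ≤ rad, against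
-- e(x) > rad.
module Submission where

open import Defs
open import Data.Nat using (ℕ; _≤_)
open import Data.Product using (∃-syntax; _×_)
open import Relation.Binary.PropositionalEquality using (_≢_)

open import Data.Nat using (zero; suc; _+_; _<_; s≤s; anyUpTo?)
open import Data.Nat.Properties
open import Data.Nat.Induction using (<-rec)
open import Data.Fin using () renaming (_≟_ to _≟ᶠ_)
open import Data.Fin.Properties using (any?)
open import Data.Bool using (true) renaming (_≟_ to _≟ᵇ_)
open import Data.Product using (∃; ∃₂; _,_; proj₁; proj₂)
open import Data.List using (allFin)
open import Data.List.Extrema.Nat using (argmax; f[xs]≤f[argmax])
open import Data.List.Membership.Propositional.Properties using (∈-allFin)
import Data.List.Relation.Unary.All as All
open import Relation.Nullary using (¬_; Dec; yes; no; contradiction)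
open import Relation.Nullary.Decidable using (map′; _×-dec_; ¬?)
open import Level using (0ℓ)
open import Relation.Unary using (Pred; Decidable)
open import Relation.Binary.PropositionalEquality
  using (_≡_; refl; trans; subst; subst₂; cong; cong₂) renaming (sym to ≡-sym)

least-witness : ∀ {p} {P : Pred ℕ p} → Decidable P →
                ∀ k → P k → ∃[ m ] (P m × (∀ n → P n → m ≤ n))
least-witness {P = P} P? = <-rec (λ k → P k → ∃[ m ] (P m × (∀ n → P n → m ≤ n))) least
  where
  least : ∀ k → (∀ {j} → j < k → P j → ∃[ m ] (P m × (∀ n → P n → m ≤ n))) →
          P k → ∃[ m ] (P m × (∀ n → P n → m ≤ n))
  least k smaller pk with anyUpTo? P? k
  ... | yes (j , j<k , pj) = smaller j<k pj
  ... | no none = k , pk , λ n pn → ≮⇒≥ (λ n<k → none (n , n<k , pn))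

module _ (G : Graph) where

  _++ʷ_ : ∀ {u v w k m} → Walk G u v k → Walk G v w m → Walk G u w (k + m)
  here     ++ʷ q = q
  step e p ++ʷ q = step e (p ++ʷ q)

  reverse : ∀ {u v k} → Walk G u v k → Walk G v u k
  reverse here = here
  reverse {k = suc k} (step {w = w} e p) =
    subst (Walk G _ _) (+-comm k 1) (reverse p ++ʷ step (trans (sym G w _) e) here)

  walk? : ∀ u v k → Dec (Walk G u v k)
  walk? u v zero with u ≟ᶠ v
  ... | yes refl = yes here
  ... | no u≢v   = no λ { here → u≢v refl }
  walk? u v (suc k) =
    map′ (λ { (w , e , p) → step e p }) (λ { (step e p) → _ , e , p })
         (any? λ w → (adj G u w ≟ᵇ true) ×-dec walk? w v k)

  IsDist-unique : ∀ {u v k m} → IsDist G u v k → IsDist G u v m → k ≡ m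
  IsDist-unique (p , p-min) (q , q-min) = ≤-antisym (p-min _ q) (q-min _ p)

  IsEcc-unique : ∀ {v e e′} → IsEcc G v e → IsEcc G v e′ → e ≡ e′
  IsEcc-unique (e-max , z , Dz) (e′-max , z′ , Dz′) = ≤-antisym (e′-max z _ Dz) (e-max z′ _ Dz′)

  walk-through : ∀ (x : Vertex G) (P : Pred (Vertex G) 0ℓ) →
                 (∀ {a w} → adj G a w ≡ true → P a → w ≢ x → P w) →
                 ∀ {a b k} → P a → ¬ P b → Walk G a b k →
                 ∃₂ λ i j → i + j ≡ k × Walk G a x i × Walk G x b j
  walk-through x P closed Pa ¬Pb here = contradiction Pa ¬Pb
  walk-through x P closed Pa ¬Pb (step {w = w} e p) with w ≟ᶠ x
  ... | yes refl = 1 , _ , refl , step e here , p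
  ... | no w≢x with walk-through x P closed (closed e Pa w≢x) ¬Pb p
  ...   | i , j , i+j≡k , q , s = suc i , j , cong suc i+j≡k , step e q , s

  module _ (connected : Connected G) where

    -- Opaque, since otherwise unification may unfold the well-founded search.
    opaque
      distance : ∀ u v → ∃ (IsDist G u v)
      distance u v = least-witness (walk? u v) _ (proj₂ (connected u v))

    dist : Vertex G → Vertex G → ℕ
    dist u v = proj₁ (distance u v)

    shortest-walk : ∀ u v → Walk G u v (dist u v)
    shortest-walk u v = proj₁ (proj₂ (distance u v))

    dist-minimal : ∀ {u v k} → Walk G u v k → dist u v ≤ k
    dist-minimal {u} {v} = proj₂ (proj₂ (distance u v)) _

    eccentric-vertex : Vertex G → Vertex G
    eccentric-vertex v = argmax (dist v) v (allFin _)

    ecc : Vertex G → ℕ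
    ecc v = dist v (eccentric-vertex v)

    dist≤ecc : ∀ v u → dist v u ≤ ecc v
    dist≤ecc v u = All.lookup (f[xs]≤f[argmax] v (allFin _)) (∈-allFin u)

    ecc-IsEcc : ∀ v → IsEcc G v (ecc v)
    ecc-IsEcc v = (λ u k Dk → subst (_≤ ecc v) (IsDist-unique (proj₂ (distance v u)) Dk) (dist≤ecc v u))
                , eccentric-vertex v , proj₂ (distance v _)

    IsEcc⇒≡ecc : ∀ {v e} → IsEcc G v e → ecc v ≡ e
    IsEcc⇒≡ecc = IsEcc-unique (ecc-IsEcc _)

    walks≤⇒ecc≤ : ∀ {x r} → (∀ y → ∃[ k ] (k ≤ r × Walk G x y k)) → ecc x ≤ r
    walks≤⇒ecc≤ {x} walks with walks (eccentric-vertex x)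
    ... | k , k≤r , p = ≤-trans (dist-minimal p) k≤r

    ecc-adjacent : ∀ {a w} → adj G a w ≡ true → ecc a ≤ suc (ecc w)
    ecc-adjacent {a} {w} e = ≤-trans (dist-minimal (step e (shortest-walk w z))) (s≤s (dist≤ecc w z))
      where
      z : Vertex G
      z = eccentric-vertex a

    ecc≤ecc+ecc : ∀ c v → ecc v ≤ ecc c + ecc c
    ecc≤ecc+ecc c v =
      ≤-trans (dist-minimal (reverse (shortest-walk c v) ++ʷ shortest-walk c z))
              (+-mono-≤ (dist≤ecc c v) (dist≤ecc c z))
      where
      z : Vertex G
      z = eccentric-vertex v

    module _ {r} (x : Vertex G) (gap : ∀ w → w ≢ x → ecc w ≢ suc r) where

      Low : Pred (Vertex G) 0ℓ
      Low w = ecc w ≤ r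

      Low-closed : ∀ {a w} → adj G a w ≡ true → Low a → w ≢ x → Low w
      Low-closed {a} {w} e low w≢x =
        m<1+n⇒m≤n (≤∧≢⇒< (≤-trans (ecc-adjacent (trans (sym G w a) e)) (s≤s low)) (gap w w≢x))

      ecc-exit≤ : ∀ {c u} → Low c → ¬ Low u → ecc x ≤ r
      ecc-exit≤ {c} {u} low-c high-u = walks≤⇒ecc≤ near
        where
        near : ∀ y → ∃[ k ] (k ≤ r × Walk G x y k)
        near y with ecc y ≤? r
        ... | yes low-y with walk-through x Low Low-closed low-y high-u (shortest-walk y u)
        ...   | i , j , i+j≡k , q , _ =
          i , ≤-trans (m≤m+n i j) (≤-trans (≤-reflexive i+j≡k) (≤-trans (dist≤ecc y u) low-y))
            , reverse q
        near y | no high-y with walk-through x Low Low-closed low-c high-y (shortest-walk c y)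
        ...   | i , j , i+j≡k , _ , s =
          j , ≤-trans (m≤n+m j i) (≤-trans (≤-reflexive i+j≡k) (≤-trans (dist≤ecc c y) low-c))
            , s

    ecc-suc-elsewhere : ∀ {r c u} x → ecc c ≤ r → r < ecc u → r < ecc x →
                        ∃[ w ] (w ≢ x × ecc w ≡ suc r)
    ecc-suc-elsewhere {r} x low-c high-u high-x
      with any? (λ w → ¬? (w ≟ᶠ x) ×-dec (ecc w ≟ suc r))
    ... | yes found = found
    ... | no none = contradiction (ecc-exit≤ x gap low-c (<⇒≱ high-u)) (<⇒≱ high-x)
      where
      gap : ∀ w → w ≢ x → ecc w ≢ suc r
      gap w w≢x ecc≡ = none (w , w≢x , ecc≡)

lemma2 : (G : Graph) → Connected G → (r d : ℕ) → IsRad G r → IsDiam G d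
    → (∃[ w ] InAnnulus G r d w)
    → 2 ≤ r × 4 ≤ d × (∃[ v ] ∃[ w ] (v ≢ w × InAnnulus G r d v × InAnnulus G r d w))
lemma2 G conn r d ((c , ec) , _) ((u , eu) , _) (x , e , ex , r<e , e<d) =
  2≤r , ≤-trans (+-monoʳ-≤ 2 2≤r) r+1<d , pair-with-x besides
  where
  ecc-c : ecc G conn c ≡ r
  ecc-c = IsEcc⇒≡ecc G conn ec
  ecc-u : ecc G conn u ≡ d
  ecc-u = IsEcc⇒≡ecc G conn eu
  r+1<d : suc r < d
  r+1<d = ≤-trans (s≤s r<e) e<d
  d≤r+r : d ≤ r + r
  d≤r+r = subst₂ _≤_ ecc-u (cong₂ _+_ ecc-c ecc-c) (ecc≤ecc+ecc G conn c u)
  2≤r : 2 ≤ r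
  2≤r = +-cancelʳ-≤ r 2 r (≤-trans r+1<d d≤r+r)
  besides : ∃[ w ] (w ≢ x × ecc G conn w ≡ suc r)
  besides = ecc-suc-elsewhere G conn x (≤-reflexive ecc-c) (subst (r <_) (≡-sym ecc-u) (<-trans r<e e<d))
                                       (subst (r <_) (≡-sym (IsEcc⇒≡ecc G conn ex)) r<e)
  pair-with-x : ∃[ w ] (w ≢ x × ecc G conn w ≡ suc r) →
                ∃[ v ] ∃[ w ] (v ≢ w × InAnnulus G r d v × InAnnulus G r d w)
  pair-with-x (w , w≢x , ecc-w) =
    w , x , w≢x , (suc r , subst (IsEcc G w) ecc-w (ecc-IsEcc G conn w) , n<1+n r , r+1<d)
              , (e , ex , r<e , e<d)
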